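{- Let $n$ be a positive integer and let $v=\{i,j\}$ and $w=\{i-1,j'\}$ be vertices of $J(n,2)$ (so $2\le i<j\le n$ and $i-1<j'\le n$), with $j'\ge j$. Let $S$ be the union of the set of vertices to the right of $w$ (i.e. $\{\{i-1,b\}: j'<b\le n\}$) and the set of vertices dominated by $v$. Then $S':=S\cup\{w\}$ is a stable set, and \[ \frac{|\partial S'|}{|S'|}\le\frac{|\partial S|}{|S|}. \]
   Context: The Johnson graph $J(n,2)$ has vertex set $\binom{[n]}{2}$, the $2$-element subsets of $[n]=\{1,\dots,n\}$, two vertices being adjacent iff they share exactly one element. A vertex is written $\{a,b\}$ with $a<b$; it is said to lie in row $a$ and column $b$. A vertex $\{a,b\}$ is to the right of $\{a,b'\}$ if $b>b'$ (same row, larger column). A vertex $\{a,b\}$ dominates a vertex $\{a',b'\}$ if $a\le a'$ and $b\le b'$. A set $S$ of vertices is stable if for every $u\in S$, every vertex dominated by $u$ is also in $S$. For $S\subseteq V$, $\partial S$ denotes the set of edges with exactly one endpoint in $S$. -}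

module Defs where

open import Data.Nat using (ℕ; zero; suc; _+_; _*_; _∸_; _≤_; _<_; _≡ᵇ_; _<ᵇ_; _≤ᵇ_)
open import Data.Nat.Properties using (_≤?_; _<?_)
open import Data.Bool using (Bool; true; false; _∧_; _∨_; _xor_; if_then_else_)
open import Data.Product using (_×_; _,_)
open import Data.Product.Relation.Binary.Pointwise.NonDependent using ()
open import Data.List using (List; filter; length; upTo; cartesianProduct)
open import Relation.Nullary.Decidable using (_×-dec_)
open import Relation.Binary.PropositionalEquality using (_≡_)

-- A vertex {a,b} of J(n,2), with a < b, is encoded as the pair (a , b).
Vertex : Set
Vertex = ℕ × ℕ

IsVertex : ℕ → Vertex → Set
IsVertex n (a , b) = 1 ≤ a × a < b × b ≤ n

isVertex? : (n : ℕ) → (u : Vertex) → Relation.Nullary.Decidable.Dec (IsVertex n u)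
isVertex? n (a , b) = (1 ≤? a) ×-dec ((a <? b) ×-dec (b ≤? n))

vertices : ℕ → List Vertex
vertices n = filter (isVertex? n) (cartesianProduct (upTo (suc n)) (upTo (suc n)))

inPair : ℕ → Vertex → Bool
inPair x (c , d) = (x ≡ᵇ c) ∨ (x ≡ᵇ d)

common : Vertex → Vertex → ℕ
common (a , b) v = (if inPair a v then 1 else 0) + (if inPair b v then 1 else 0)

Adjacent : Vertex → Vertex → Set
Adjacent u v = common u v ≡ 1

-- strict lexicographic order, used to list each (unordered) edge once
lexLt : Vertex → Vertex → Set
lexLt (a , b) (c , d) = (a < c) Data.Sum.⊎ (a ≡ c × b < d)
  where import Data.Sum

lexLt? : (u v : Vertex) → Relation.Nullary.Decidable.Dec (lexLt u v)
lexLt? (a , b) (c , d) =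
  Relation.Nullary.Decidable._⊎-dec_ (a <? c) (Data.Nat._≟_ a c ×-dec (b <? d))

edges : ℕ → List (Vertex × Vertex)
edges n = filter (λ e → lexLt? (Data.Product.proj₁ e) (Data.Product.proj₂ e)
                          ×-dec (Data.Nat._≟_ (common (Data.Product.proj₁ e) (Data.Product.proj₂ e)) 1))
                 (cartesianProduct (vertices n) (vertices n))
  where import Data.Product

VSet : Set
VSet = Vertex → Bool

card : ℕ → VSet → ℕ
card n S = length (filter (λ u → Data.Bool._≟_ (S u) true) (vertices n))

boundary : ℕ → VSet → ℕ
boundary n S = length (filter (λ e → Data.Bool._≟_ (S (Data.Product.proj₁ e) xor S (Data.Product.proj₂ e)) true) (edges n))
  where import Data.Product

Dominates : Vertex → Vertex → Set
Dominates (a , b) (a' , b') = a ≤ a' × b ≤ b'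

Stable : ℕ → VSet → Set
Stable n S = ∀ u x → IsVertex n u → IsVertex n x → S u ≡ true → Dominates u x → S x ≡ true

setS : ℕ → ℕ → ℕ → ℕ → VSet
setS n i j j' (a , b) =
  ((a ≡ᵇ (i ∸ 1)) ∧ (j' <ᵇ b) ∧ (b ≤ᵇ n))
  ∨ ((1 ≤ᵇ a) ∧ (a <ᵇ b) ∧ (b ≤ᵇ n) ∧ (i ≤ᵇ a) ∧ (j ≤ᵇ b))

setS' : ℕ → ℕ → ℕ → ℕ → VSet
setS' n i j j' (a , b) = setS n i j j' (a , b) ∨ ((a ≡ᵇ (i ∸ 1)) ∧ (b ≡ᵇ j'))

-- Write p = i − 1 and w = {p, j′}, so S′ = S ∪ {w} with w ∉ S. Adding w changes the boundary
-- by the number of neighbours of w outside S′ minus the number of neighbours of w in S. The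
-- former are the {c, p} and {c, j′} with c < p, and the {p, d} with i ≤ d < j′; the latter
-- include the {d, j′} with i ≤ d < j′, which match the third family. Hence
-- |∂S′| ≤ |∂S| + 2(i − 2). Conversely every vertex {a, b} of S has a ≥ p, so the 2(i − 2)
-- vertices {c, a}, {c, b} with c < p are neighbours of it outside S, and |∂S| ≥ 2(i − 2)|S|.
-- Together, |∂S′| |S| ≤ (|∂S| + 2(i − 2)) |S| ≤ |∂S| (|S| + 1) = |∂S| |S′|.

module Submission where

open import Defs
open import Data.Nat using (ℕ; zero; suc; _+_; _*_; _≤_; _<_; _≡ᵇ_; z≤n; s≤s; s≤s⁻¹)
open import Data.Nat.Properties
open import Data.Bool using (Bool; true; false; _∧_; _∨_; _xor_; not; T; if_then_else_)
open import Data.Bool.Properties using (T-≡; T-∧; ∧-assoc; ∧-comm; ∧-zeroʳ; xor-comm)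
open import Data.Product using (_×_; _,_; proj₁; proj₂)
open import Data.Sum using (_⊎_; inj₁; inj₂; [_,_])
open import Data.Empty using (⊥; ⊥-elim)
open import Data.List using (List; []; _∷_; _++_; map; filter; length; upTo; cartesianProduct)
open import Data.List.Properties using (upTo-∷ʳ)
open import Data.List.Relation.Unary.All using (All; []; _∷_)
open import Data.List.Relation.Unary.All.Properties using (all-filter)
open import Function using (_∘_)
open import Function.Bundles using (Equivalence)
open import Relation.Nullary using (¬_; Dec; does; _because_; yes; no)
open import Relation.Nullary.Reflects using (invert)
open import Relation.Nullary.Decidable using (dec-true; dec-false; _×-dec_; _⊎-dec_; ¬?)
open import Relation.Unary using (Decidable)
open import Relation.Binary using (tri<; tri≈; tri>)
open import Relation.Binary.PropositionalEquality using (_≡_; _≢_; refl; sym; trans; cong; cong₂; subst; module ≡-Reasoning)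
open import Data.Product.Relation.Binary.Lex.Strict using (×-compare)
open import Algebra.Properties.CommutativeSemigroup +-commutativeSemigroup using (interchange)

𝟙 : Bool → ℕ
𝟙 b = if b then 1 else 0

𝟙-∧ : ∀ x y → 𝟙 (x ∧ y) ≡ 𝟙 x * 𝟙 y
𝟙-∧ true  y = sym (+-identityʳ (𝟙 y))
𝟙-∧ false y = refl

𝟙-mono-≤ : ∀ {x y} → (T x → T y) → 𝟙 x ≤ 𝟙 y
𝟙-mono-≤ {false} _ = z≤n
𝟙-mono-≤ {true} {true} _ = ≤-refl
𝟙-mono-≤ {true} {false} x⇒y = ⊥-elim (x⇒y _)

𝟙-∨-≤ : ∀ x y → 𝟙 (x ∨ y) ≤ 𝟙 x + 𝟙 y
𝟙-∨-≤ true  y = s≤s z≤n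
𝟙-∨-≤ false y = ≤-refl

𝟙-∨ : ∀ {x y} → (T x → T y → ⊥) → 𝟙 (x ∨ y) ≡ 𝟙 x + 𝟙 y
𝟙-∨ {true} {true} disj = ⊥-elim (disj _ _)
𝟙-∨ {true} {false} _ = refl
𝟙-∨ {false} _ = refl

𝟙-absorb : ∀ {x y} m → (T y → T x) → 𝟙 x * (𝟙 y * m) ≡ 𝟙 y * m
𝟙-absorb {true} m _ = +-identityʳ _
𝟙-absorb {false} {false} m _ = refl
𝟙-absorb {false} {true} m y⇒x = ⊥-elim (y⇒x _)

𝟙-scale-≤ : ∀ {x} k m → (T x → k ≤ m) → k * 𝟙 x ≤ 𝟙 x * m
𝟙-scale-≤ {true} k m k≤m = begin
  k * 1 ≡⟨ *-identityʳ k ⟩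
  k     ≤⟨ k≤m _ ⟩
  m     ≡⟨ sym (+-identityʳ m) ⟩
  1 * m ∎
  where open ≤-Reasoning
𝟙-scale-≤ {false} k m _ = ≤-reflexive (*-zeroʳ k)

𝟙-∧-split : ∀ {l l′} a → (T a → l′ ≡ not l) → 𝟙 (l ∧ a) + 𝟙 (l′ ∧ a) ≡ 𝟙 a
𝟙-∧-split {l} {l′} false _ rewrite ∧-zeroʳ l | ∧-zeroʳ l′ = refl
𝟙-∧-split {true}  true flipped rewrite flipped _ = refl
𝟙-∧-split {false} true flipped rewrite flipped _ = refl

𝟙-xor : ∀ x y a → 𝟙 (x ∧ (not y ∧ a)) + 𝟙 (y ∧ (not x ∧ a)) ≡ 𝟙 (x xor y) * 𝟙 a
𝟙-xor true  true  a = refl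
𝟙-xor true  false a = refl
𝟙-xor false true  a = sym (+-identityʳ (𝟙 a))
𝟙-xor false false a = refl

𝟙-insert : ∀ {au eu av ev} x → (T au → T eu → ⊥) → (T av → T ev → ⊥) →
  𝟙 ((au ∨ eu) ∧ (not (av ∨ ev) ∧ x)) + 𝟙 (au ∧ (ev ∧ x)) ≡ 𝟙 (au ∧ (not av ∧ x)) + 𝟙 (eu ∧ (not (av ∨ ev) ∧ x))
𝟙-insert {true}  {true}                  x u-disj _ = ⊥-elim (u-disj _ _)
𝟙-insert {_}     {_}     {true}  {true}  x _ v-disj = ⊥-elim (v-disj _ _)
𝟙-insert {true}  {false} {true}  {false} x _ _ = refl
𝟙-insert {true}  {false} {false} {true}  x _ _ = sym (+-identityʳ (𝟙 x))
𝟙-insert {true}  {false} {false} {false} x _ _ = refl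
𝟙-insert {false} {true}                  x _ _ = +-identityʳ _
𝟙-insert {false} {false}                 x _ _ = refl

does-complete : ∀ {P : Set} (P? : Dec P) → P → T (does P?)
does-complete P? p = Equivalence.from T-≡ (dec-true P? p)

does-sound : ∀ {P : Set} (P? : Dec P) → T (does P?) → P
does-sound (true because [p]) _ = invert [p]

𝟙-mono-does : ∀ {P Q : Set} (P? : Dec P) (Q? : Dec Q) → (P → Q) → 𝟙 (does P?) ≤ 𝟙 (does Q?)
𝟙-mono-does P? Q? P⇒Q = 𝟙-mono-≤ (does-complete Q? ∘ P⇒Q ∘ does-sound P?)

𝟙-+-≤ : ∀ {P Q R : Set} (P? : Dec P) (Q? : Dec Q) (R? : Dec R) → (P → Q → ⊥) → (P ⊎ Q → R) →
  𝟙 (does P?) + 𝟙 (does Q?) ≤ 𝟙 (does R?)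
𝟙-+-≤ P? Q? R? disj P⊎Q⇒R = begin
  𝟙 (does P?) + 𝟙 (does Q?)   ≡⟨ 𝟙-∨ (λ p q → disj (does-sound P? p) (does-sound Q? q)) ⟨
  𝟙 (does (P? ⊎-dec Q?))      ≤⟨ 𝟙-mono-does (P? ⊎-dec Q?) R? P⊎Q⇒R ⟩
  𝟙 (does R?)                 ∎
  where open ≤-Reasoning

𝟙-≤-+ : ∀ {P Q R : Set} (P? : Dec P) (Q? : Dec Q) (R? : Dec R) → (R → P ⊎ Q) →
  𝟙 (does R?) ≤ 𝟙 (does P?) + 𝟙 (does Q?)
𝟙-≤-+ P? Q? R? R⇒P⊎Q = ≤-trans (𝟙-mono-does R? (P? ⊎-dec Q?) R⇒P⊎Q) (𝟙-∨-≤ (does P?) (does Q?))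

∑ : {A : Set} → List A → (A → ℕ) → ℕ
∑ []       f = 0
∑ (x ∷ xs) f = f x + ∑ xs f

syntax ∑ xs (λ x → e) = ∑[ x ∈ xs ] e

module _ {A : Set} where

  ∑-cong : ∀ xs {f g : A → ℕ} → (∀ x → f x ≡ g x) → ∑ xs f ≡ ∑ xs g
  ∑-cong []       f≗g = refl
  ∑-cong (x ∷ xs) f≗g = cong₂ _+_ (f≗g x) (∑-cong xs f≗g)

  ∑-congᴬ : ∀ {P : A → Set} {xs} {f g : A → ℕ} → All P xs → (∀ {x} → P x → f x ≡ g x) → ∑ xs f ≡ ∑ xs g
  ∑-congᴬ []         f≗g = refl
  ∑-congᴬ (px ∷ pxs) f≗g = cong₂ _+_ (f≗g px) (∑-congᴬ pxs f≗g)

  ∑-mono-≤ : ∀ xs {f g : A → ℕ} → (∀ x → f x ≤ g x) → ∑ xs f ≤ ∑ xs g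
  ∑-mono-≤ []       f≤g = z≤n
  ∑-mono-≤ (x ∷ xs) f≤g = +-mono-≤ (f≤g x) (∑-mono-≤ xs f≤g)

  ∑-monoᴬ-≤ : ∀ {P : A → Set} {xs} {f g : A → ℕ} → All P xs → (∀ {x} → P x → f x ≤ g x) → ∑ xs f ≤ ∑ xs g
  ∑-monoᴬ-≤ []         f≤g = z≤n
  ∑-monoᴬ-≤ (px ∷ pxs) f≤g = +-mono-≤ (f≤g px) (∑-monoᴬ-≤ pxs f≤g)

  ∑-distrib-+ : ∀ xs (f g : A → ℕ) → ∑[ x ∈ xs ] (f x + g x) ≡ ∑ xs f + ∑ xs g
  ∑-distrib-+ []       f g = refl
  ∑-distrib-+ (x ∷ xs) f g =
    trans (cong (f x + g x +_) (∑-distrib-+ xs f g)) (interchange (f x) (g x) (∑ xs f) (∑ xs g))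

  ∑-*ˡ : ∀ xs k (f : A → ℕ) → ∑[ x ∈ xs ] (k * f x) ≡ k * ∑ xs f
  ∑-*ˡ []       k f = sym (*-zeroʳ k)
  ∑-*ˡ (x ∷ xs) k f = trans (cong (k * f x +_) (∑-*ˡ xs k f)) (sym (*-distribˡ-+ k (f x) (∑ xs f)))

  ∑-++ : ∀ xs ys (f : A → ℕ) → ∑ (xs ++ ys) f ≡ ∑ xs f + ∑ ys f
  ∑-++ []       ys f = refl
  ∑-++ (x ∷ xs) ys f = trans (cong (f x +_) (∑-++ xs ys f)) (sym (+-assoc (f x) (∑ xs f) (∑ ys f)))

  ∑-map : ∀ {B : Set} (g : B → A) xs (f : A → ℕ) → ∑ (map g xs) f ≡ ∑ xs (f ∘ g)
  ∑-map g []       f = refl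
  ∑-map g (x ∷ xs) f = cong (f (g x) +_) (∑-map g xs f)

  ∑-zero : ∀ (xs : List A) → ∑[ x ∈ xs ] 0 ≡ 0
  ∑-zero []       = refl
  ∑-zero (x ∷ xs) = ∑-zero xs

  length-filter : ∀ {P : A → Set} (P? : Decidable P) xs → length (filter P? xs) ≡ ∑[ x ∈ xs ] 𝟙 (does (P? x))
  length-filter P? []       = refl
  length-filter P? (x ∷ xs) with does (P? x)
  ... | true  = cong suc (length-filter P? xs)
  ... | false = length-filter P? xs

  ∑-filter : ∀ {P : A → Set} (P? : Decidable P) xs (f : A → ℕ) → ∑ (filter P? xs) f ≡ ∑[ x ∈ xs ] (𝟙 (does (P? x)) * f x)
  ∑-filter P? []       f = refl
  ∑-filter P? (x ∷ xs) f with does (P? x)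
  ... | true  = cong₂ _+_ (sym (+-identityʳ (f x))) (∑-filter P? xs f)
  ... | false = ∑-filter P? xs f

module _ {A B : Set} where

  ∑-cartesianProduct : ∀ (xs : List A) (ys : List B) f →
    ∑ (cartesianProduct xs ys) f ≡ ∑[ x ∈ xs ] ∑[ y ∈ ys ] f (x , y)
  ∑-cartesianProduct []       ys f = refl
  ∑-cartesianProduct (x ∷ xs) ys f = trans (∑-++ (map (x ,_) ys) _ f)
    (cong₂ _+_ (∑-map (x ,_) ys f) (∑-cartesianProduct xs ys f))

  ∑-comm : ∀ (xs : List A) (ys : List B) (f : A → B → ℕ) →
    ∑[ x ∈ xs ] ∑[ y ∈ ys ] f x y ≡ ∑[ y ∈ ys ] ∑[ x ∈ xs ] f x y
  ∑-comm []       ys f = sym (∑-zero ys)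
  ∑-comm (x ∷ xs) ys f = trans (cong (∑ ys (f x) +_) (∑-comm xs ys f))
    (sym (∑-distrib-+ ys (f x) (λ y → ∑[ x′ ∈ xs ] f x′ y)))

∑∑-distrib-+ : ∀ {A B : Set} (xs : List A) (ys : List B) (f g : A → B → ℕ) →
  ∑[ x ∈ xs ] ∑[ y ∈ ys ] (f x y + g x y) ≡ ∑[ x ∈ xs ] ∑[ y ∈ ys ] f x y + ∑[ x ∈ xs ] ∑[ y ∈ ys ] g x y
∑∑-distrib-+ xs ys f g = trans (∑-cong xs (λ x → ∑-distrib-+ ys (f x) (g x))) (∑-distrib-+ xs _ _)

∑-upTo-suc : ∀ N (f : ℕ → ℕ) → ∑ (upTo (suc N)) f ≡ ∑ (upTo N) f + f N
∑-upTo-suc N f = begin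
  ∑ (upTo (suc N)) f          ≡⟨ cong (λ xs → ∑ xs f) (sym (upTo-∷ʳ N)) ⟩
  ∑ (upTo N ++ N ∷ []) f      ≡⟨ ∑-++ (upTo N) (N ∷ []) f ⟩
  ∑ (upTo N) f + (f N + 0)    ≡⟨ cong (∑ (upTo N) f +_) (+-identityʳ (f N)) ⟩
  ∑ (upTo N) f + f N          ∎
  where open ≡-Reasoning

∑-upTo-δ-absent : ∀ N {p} (h : ℕ → ℕ) → N ≤ p → ∑[ a ∈ upTo N ] (𝟙 (a ≡ᵇ p) * h a) ≡ 0
∑-upTo-δ-absent zero    h _ = refl
∑-upTo-δ-absent (suc N) {p} h N<p
  rewrite ∑-upTo-suc N (λ a → 𝟙 (a ≡ᵇ p) * h a)
        | ∑-upTo-δ-absent N h (<⇒≤ N<p)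
        | dec-false (N ≟ p) (<⇒≢ N<p) = refl

∑-upTo-δ : ∀ N {p} (h : ℕ → ℕ) → p < N → ∑[ a ∈ upTo N ] (𝟙 (a ≡ᵇ p) * h a) ≡ h p
∑-upTo-δ (suc N) {p} h p<1+N rewrite ∑-upTo-suc N (λ a → 𝟙 (a ≡ᵇ p) * h a)
  with m≤n⇒m<n∨m≡n (s≤s⁻¹ p<1+N)
... | inj₁ p<N  rewrite ∑-upTo-δ N h p<N | dec-false (N ≟ p) (>⇒≢ p<N) = +-identityʳ (h p)
... | inj₂ refl rewrite ∑-upTo-δ-absent N h ≤-refl | dec-true (N ≟ N) refl = +-identityʳ (h N)

∑∑-column : ∀ N {e} (g : ℕ → Bool) → e < N →
  ∑[ c ∈ upTo N ] ∑[ d ∈ upTo N ] 𝟙 ((d ≡ᵇ e) ∧ g c) ≡ ∑[ c ∈ upTo N ] 𝟙 (g c)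
∑∑-column N {e} g e<N = ∑-cong (upTo N) (λ c →
  trans (∑-cong (upTo N) (λ d → 𝟙-∧ (d ≡ᵇ e) (g c))) (∑-upTo-δ N (λ _ → 𝟙 (g c)) e<N))

∑∑-row : ∀ N {e} (g : ℕ → Bool) → e < N →
  ∑[ c ∈ upTo N ] ∑[ d ∈ upTo N ] 𝟙 ((c ≡ᵇ e) ∧ g d) ≡ ∑[ d ∈ upTo N ] 𝟙 (g d)
∑∑-row N {e} g e<N = trans
  (∑-cong (upTo N) (λ c → trans (∑-cong (upTo N) (λ d → 𝟙-∧ (c ≡ᵇ e) (g d))) (∑-*ˡ (upTo N) (𝟙 (c ≡ᵇ e)) _)))
  (∑-upTo-δ N (λ _ → ∑[ d ∈ upTo N ] 𝟙 (g d)) e<N)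

+-double-injective : ∀ {m n} → m + m ≡ n + n → m ≡ n
+-double-injective {m} {n} m+m≡n+n = *-cancelˡ-≡ m n 2 (begin
  m + (m + 0) ≡⟨ cong (m +_) (+-identityʳ m) ⟩
  m + m       ≡⟨ m+m≡n+n ⟩
  n + n       ≡⟨ cong (n +_) (sym (+-identityʳ n)) ⟩
  n + (n + 0) ∎)
  where open ≡-Reasoning

module _ {A : Set} where

  ∑∑-with-transpose : ∀ (xs : List A) (f : A → A → ℕ) →
    ∑[ u ∈ xs ] ∑[ v ∈ xs ] (f u v + f v u) ≡ ∑[ u ∈ xs ] ∑[ v ∈ xs ] f u v + ∑[ u ∈ xs ] ∑[ v ∈ xs ] f u v
  ∑∑-with-transpose xs f = begin
    ∑[ u ∈ xs ] ∑[ v ∈ xs ] (f u v + f v u)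
      ≡⟨ ∑-cong xs (λ u → ∑-distrib-+ xs (f u) (λ v → f v u)) ⟩
    ∑[ u ∈ xs ] (∑[ v ∈ xs ] f u v + ∑[ v ∈ xs ] f v u)
      ≡⟨ ∑-distrib-+ xs (λ u → ∑ xs (f u)) (λ u → ∑[ v ∈ xs ] f v u) ⟩
    ∑[ u ∈ xs ] ∑[ v ∈ xs ] f u v + ∑[ u ∈ xs ] ∑[ v ∈ xs ] f v u
      ≡⟨ cong (∑[ u ∈ xs ] ∑[ v ∈ xs ] f u v +_) (sym (∑-comm xs xs f)) ⟩
    ∑[ u ∈ xs ] ∑[ v ∈ xs ] f u v + ∑[ u ∈ xs ] ∑[ v ∈ xs ] f u v ∎
    where open ≡-Reasoning

  ∑∑-symmetrise : ∀ {P : A → Set} {xs} (f g : A → A → ℕ) → All P xs →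
    (∀ {u v} → P u → P v → f u v + f v u ≡ g u v + g v u) →
    ∑[ u ∈ xs ] ∑[ v ∈ xs ] f u v ≡ ∑[ u ∈ xs ] ∑[ v ∈ xs ] g u v
  ∑∑-symmetrise {xs = xs} f g all-P f⁺≡g⁺ = +-double-injective (begin
    ∑∑ f + ∑∑ f                                ≡⟨ ∑∑-with-transpose xs f ⟨
    ∑[ u ∈ xs ] ∑[ v ∈ xs ] (f u v + f v u)    ≡⟨ ∑-congᴬ all-P (λ pu → ∑-congᴬ all-P (λ pv → f⁺≡g⁺ pu pv)) ⟩
    ∑[ u ∈ xs ] ∑[ v ∈ xs ] (g u v + g v u)    ≡⟨ ∑∑-with-transpose xs g ⟩
    ∑∑ g + ∑∑ g                                ∎)
    where
    open ≡-Reasoning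
    ∑∑ : (A → A → ℕ) → ℕ
    ∑∑ h = ∑[ u ∈ xs ] ∑[ v ∈ xs ] h u v

adjacent? : ∀ u v → Dec (Adjacent u v)
adjacent? u v = common u v ≟ 1

∈pair? : ∀ x (v : Vertex) → Dec (x ≡ proj₁ v ⊎ x ≡ proj₂ v)
∈pair? x (c , d) = (x ≟ c) ⊎-dec (x ≟ d)

≡ᵇ-comm : ∀ m n → (m ≡ᵇ n) ≡ (n ≡ᵇ m)
≡ᵇ-comm m n with m ≟ n
... | yes m≡n = trans (dec-true (m ≟ n) m≡n) (sym (dec-true (n ≟ m) (sym m≡n)))
... | no m≢n  = trans (dec-false (m ≟ n) m≢n) (sym (dec-false (n ≟ m) (m≢n ∘ sym)))

common-expand : ∀ a b {c d} → c ≢ d →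
  common (a , b) (c , d) ≡ (𝟙 (a ≡ᵇ c) + 𝟙 (a ≡ᵇ d)) + (𝟙 (b ≡ᵇ c) + 𝟙 (b ≡ᵇ d))
common-expand a b {c} {d} c≢d = cong₂ _+_ (𝟙-∨ (apart a)) (𝟙-∨ (apart b))
  where
  apart : ∀ x → T (x ≡ᵇ c) → T (x ≡ᵇ d) → ⊥
  apart x x≡c x≡d = c≢d (trans (sym (≡ᵇ⇒≡ x c x≡c)) (≡ᵇ⇒≡ x d x≡d))

common-comm : ∀ {a b c d} → a ≢ b → c ≢ d → common (a , b) (c , d) ≡ common (c , d) (a , b)
common-comm {a} {b} {c} {d} a≢b c≢d = begin
  common (a , b) (c , d)                                   ≡⟨ common-expand a b c≢d ⟩
  (𝟙 (a ≡ᵇ c) + 𝟙 (a ≡ᵇ d)) + (𝟙 (b ≡ᵇ c) + 𝟙 (b ≡ᵇ d))   ≡⟨ interchange (𝟙 (a ≡ᵇ c)) _ _ _ ⟩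
  (𝟙 (a ≡ᵇ c) + 𝟙 (b ≡ᵇ c)) + (𝟙 (a ≡ᵇ d) + 𝟙 (b ≡ᵇ d))   ≡⟨ cong₂ _+_ (cong₂ _+_ (flip a c) (flip b c)) (cong₂ _+_ (flip a d) (flip b d)) ⟩
  (𝟙 (c ≡ᵇ a) + 𝟙 (c ≡ᵇ b)) + (𝟙 (d ≡ᵇ a) + 𝟙 (d ≡ᵇ b))   ≡⟨ common-expand c d a≢b ⟨
  common (c , d) (a , b)                                   ∎
  where
  open ≡-Reasoning
  flip : ∀ x y → 𝟙 (x ≡ᵇ y) ≡ 𝟙 (y ≡ᵇ x)
  flip x y = cong 𝟙 (≡ᵇ-comm x y)

adjacent-sym : ∀ {n u v} → IsVertex n u → IsVertex n v → does (adjacent? u v) ≡ does (adjacent? v u)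
adjacent-sym {u = a , b} {c , d} (_ , a<b , _) (_ , c<d , _) = cong (_≡ᵇ 1) (common-comm (<⇒≢ a<b) (<⇒≢ c<d))

adjacent-irrefl : ∀ u → ¬ Adjacent u u
adjacent-irrefl (a , b) rewrite dec-true (∈pair? a (a , b)) (inj₁ refl) | dec-true (∈pair? b (a , b)) (inj₂ refl) = λ ()

shares-first⇒adjacent : ∀ {a b v} → does (∈pair? a v) ≡ true → does (∈pair? b v) ≡ false → Adjacent (a , b) v
shares-first⇒adjacent {v = c , d} a∈v b∉v rewrite a∈v | b∉v = refl

shares-second⇒adjacent : ∀ {a b v} → does (∈pair? a v) ≡ false → does (∈pair? b v) ≡ true → Adjacent (a , b) v
shares-second⇒adjacent {v = c , d} a∉v b∈v rewrite a∉v | b∈v = refl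

adjacent⇒shares : ∀ {a b v} → Adjacent (a , b) v → (a ≡ proj₁ v ⊎ a ≡ proj₂ v) ⊎ (b ≡ proj₁ v ⊎ b ≡ proj₂ v)
adjacent⇒shares {a} {b} {v} adj with ∈pair? a v | ∈pair? b v
... | yes a∈v | _       = inj₁ a∈v
... | no _    | yes b∈v = inj₂ b∈v
... | no a∉v  | no b∉v  = ⊥-elim (0≢1+n (begin
  0                       ≡⟨ cong₂ (λ x y → 𝟙 x + 𝟙 y) (dec-false (∈pair? a v) a∉v) (dec-false (∈pair? b v) b∉v) ⟨
  common (a , b) v        ≡⟨ adj ⟩
  1                       ∎))
  where open ≡-Reasoning

lexLt-flip : ∀ u v → u ≢ v → does (lexLt? v u) ≡ not (does (lexLt? u v))
lexLt-flip (a , b) (c , d) u≢v with ×-compare sym <-cmp <-cmp (a , b) (c , d)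
... | tri< u<v _ v≮u =
  trans (dec-false (lexLt? (c , d) (a , b)) v≮u) (cong not (sym (dec-true (lexLt? (a , b) (c , d)) u<v)))
... | tri≈ _ (a≡c , b≡d) _ = ⊥-elim (u≢v (cong₂ _,_ a≡c b≡d))
... | tri> u≮v _ v<u =
  trans (dec-true (lexLt? (c , d) (a , b)) v<u) (cong not (sym (dec-false (lexLt? (a , b) (c , d)) u≮v)))

_∪_ : VSet → VSet → VSet
(A ∪ B) u = A u ∨ B u

∁ : VSet → VSet
∁ A u = not (A u)

｛_｝ : Vertex → VSet
｛ c , d ｝ (a , b) = (a ≡ᵇ c) ∧ (b ≡ᵇ d)

T-｛｝ : ∀ {w u} → T (｛ w ｝ u) → u ≡ w
T-｛｝ {c , d} {a , b} u∈w with ≡ᵇ⇒≡ a c (proj₁ (Equivalence.to T-∧ u∈w)) | ≡ᵇ⇒≡ b d (proj₂ (Equivalence.to T-∧ u∈w))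
... | refl | refl = refl

Disjoint : VSet → VSet → Set
Disjoint A B = ∀ u → T (A u) → T (B u) → ⊥

Disjoint-｛｝ : ∀ {A w} → ¬ T (A w) → Disjoint A ｛ w ｝
Disjoint-｛｝ {A} w∉A u u∈A u∈w = w∉A (subst (T ∘ A) (T-｛｝ u∈w) u∈A)

edgesBetween : ℕ → VSet → VSet → ℕ
edgesBetween n A B = ∑[ u ∈ vertices n ] ∑[ v ∈ vertices n ] 𝟙 (A u ∧ (B v ∧ does (adjacent? u v)))

degreeInto : ℕ → VSet → Vertex → ℕ
degreeInto n B u = ∑[ v ∈ vertices n ] 𝟙 (B v ∧ does (adjacent? u v))

all-vertices : ∀ n → All (IsVertex n) (vertices n)
all-vertices n = all-filter (isVertex? n) (cartesianProduct (upTo (suc n)) (upTo (suc n)))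

does-≟-true : ∀ b → does (b Data.Bool.≟ true) ≡ b
does-≟-true true  = refl
does-≟-true false = refl

card≡∑ : ∀ n A → card n A ≡ ∑[ u ∈ vertices n ] 𝟙 (A u)
card≡∑ n A = trans (length-filter _ (vertices n)) (∑-cong (vertices n) (λ u → cong 𝟙 (does-≟-true (A u))))

∑-vertices-grid : ∀ n (f : Vertex → ℕ) →
  ∑ (vertices n) f ≡ ∑[ a ∈ upTo (suc n) ] ∑[ b ∈ upTo (suc n) ] (𝟙 (does (isVertex? n (a , b))) * f (a , b))
∑-vertices-grid n f = trans (∑-filter (isVertex? n) (cartesianProduct U U) f) (∑-cartesianProduct U U _)
  where U = upTo (suc n)

∑-vertices-δ : ∀ {n w} (f : Vertex → ℕ) → IsVertex n w → ∑[ v ∈ vertices n ] (𝟙 (｛ w ｝ v) * f v) ≡ f w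
∑-vertices-δ {n} {c , d} f w∈V@(_ , c<d , d≤n) = begin
  ∑[ v ∈ vertices n ] (𝟙 (｛ c , d ｝ v) * f v)                                    ≡⟨ ∑-vertices-grid n _ ⟩
  ∑[ a ∈ U ] ∑[ b ∈ U ] (𝟙 (does (isVertex? n (a , b))) * (𝟙 (｛ c , d ｝ (a , b)) * f (a , b)))
    ≡⟨ ∑-cong U (λ a → ∑-cong U (λ b → restrict a b)) ⟩
  ∑[ a ∈ U ] ∑[ b ∈ U ] (𝟙 (a ≡ᵇ c) * (𝟙 (b ≡ᵇ d) * f (a , b)))
    ≡⟨ ∑-cong U (λ a → ∑-*ˡ U (𝟙 (a ≡ᵇ c)) _) ⟩
  ∑[ a ∈ U ] (𝟙 (a ≡ᵇ c) * ∑[ b ∈ U ] (𝟙 (b ≡ᵇ d) * f (a , b)))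
    ≡⟨ ∑-cong U (λ a → cong (𝟙 (a ≡ᵇ c) *_) (∑-upTo-δ (suc n) (λ b → f (a , b)) (s≤s d≤n))) ⟩
  ∑[ a ∈ U ] (𝟙 (a ≡ᵇ c) * f (a , d))                                             ≡⟨ ∑-upTo-δ (suc n) (λ a → f (a , d)) (s≤s (≤-trans (<⇒≤ c<d) d≤n)) ⟩
  f (c , d)                                                                       ∎
  where
  open ≡-Reasoning
  U = upTo (suc n)
  restrict : ∀ a b → 𝟙 (does (isVertex? n (a , b))) * (𝟙 (｛ c , d ｝ (a , b)) * f (a , b)) ≡ 𝟙 (a ≡ᵇ c) * (𝟙 (b ≡ᵇ d) * f (a , b))
  restrict a b = begin
    𝟙 (does (isVertex? n (a , b))) * (𝟙 (｛ c , d ｝ (a , b)) * f (a , b))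
      ≡⟨ 𝟙-absorb {does (isVertex? n (a , b))} {｛ c , d ｝ (a , b)} (f (a , b))
           (λ u∈w → subst (T ∘ does ∘ isVertex? n) (sym (T-｛｝ {c , d} {a , b} u∈w)) (does-complete (isVertex? n (c , d)) w∈V)) ⟩
    𝟙 ((a ≡ᵇ c) ∧ (b ≡ᵇ d)) * f (a , b)       ≡⟨ cong (_* f (a , b)) (𝟙-∧ (a ≡ᵇ c) (b ≡ᵇ d)) ⟩
    𝟙 (a ≡ᵇ c) * 𝟙 (b ≡ᵇ d) * f (a , b)       ≡⟨ *-assoc (𝟙 (a ≡ᵇ c)) _ _ ⟩
    𝟙 (a ≡ᵇ c) * (𝟙 (b ≡ᵇ d) * f (a , b))     ∎

degreeInto-grid : ∀ n B u → degreeInto n B u ≡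
  ∑[ c ∈ upTo (suc n) ] ∑[ d ∈ upTo (suc n) ] 𝟙 (does (isVertex? n (c , d)) ∧ (B (c , d) ∧ does (adjacent? u (c , d))))
degreeInto-grid n B u = trans (∑-vertices-grid n _)
  (∑-cong (upTo (suc n)) (λ c → ∑-cong (upTo (suc n)) (λ d → sym (𝟙-∧ (does (isVertex? n (c , d))) _))))

-- The lexicographically ordered edges and the ordered pairs (u ∈ A, v ∉ A) are two halves of
-- the symmetric count of adjacent pairs separated by A.
boundary≡edgesBetween : ∀ n A → boundary n A ≡ edgesBetween n A (∁ A)
boundary≡edgesBetween n A = begin
  boundary n A                                            ≡⟨ length-filter _ (edges n) ⟩
  ∑[ e ∈ edges n ] 𝟙 (does ((A (proj₁ e) xor A (proj₂ e)) Data.Bool.≟ true))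
    ≡⟨ ∑-cong (edges n) (λ e → cong 𝟙 (does-≟-true (A (proj₁ e) xor A (proj₂ e)))) ⟩
  ∑[ e ∈ edges n ] 𝟙 (A (proj₁ e) xor A (proj₂ e))        ≡⟨ ∑-filter _ (cartesianProduct V V) _ ⟩
  ∑[ e ∈ cartesianProduct V V ] (𝟙 (ℓ (proj₁ e) (proj₂ e) ∧ α (proj₁ e) (proj₂ e)) * 𝟙 (A (proj₁ e) xor A (proj₂ e)))
    ≡⟨ ∑-cartesianProduct V V _ ⟩
  ∑[ u ∈ V ] ∑[ v ∈ V ] (𝟙 (ℓ u v ∧ α u v) * 𝟙 (A u xor A v))
    ≡⟨ ∑∑-symmetrise _ _ (all-vertices n) orientations ⟩
  edgesBetween n A (∁ A)                                  ∎
  where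
  open ≡-Reasoning
  V = vertices n
  ℓ α : Vertex → Vertex → Bool
  ℓ u v = does (lexLt? u v)
  α u v = does (adjacent? u v)

  orientations : ∀ {u v} → IsVertex n u → IsVertex n v →
    𝟙 (ℓ u v ∧ α u v) * 𝟙 (A u xor A v) + 𝟙 (ℓ v u ∧ α v u) * 𝟙 (A v xor A u)
    ≡ 𝟙 (A u ∧ (not (A v) ∧ α u v)) + 𝟙 (A v ∧ (not (A u) ∧ α v u))
  orientations {u} {v} u∈V v∈V rewrite adjacent-sym v∈V u∈V | xor-comm (A v) (A u) = begin
    𝟙 (ℓ u v ∧ α u v) * 𝟙 (A u xor A v) + 𝟙 (ℓ v u ∧ α u v) * 𝟙 (A u xor A v)
      ≡⟨ *-distribʳ-+ (𝟙 (A u xor A v)) (𝟙 (ℓ u v ∧ α u v)) _ ⟨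
    (𝟙 (ℓ u v ∧ α u v) + 𝟙 (ℓ v u ∧ α u v)) * 𝟙 (A u xor A v)
      ≡⟨ cong (_* 𝟙 (A u xor A v)) (𝟙-∧-split (α u v) (λ adj → lexLt-flip u v (λ { refl →
           adjacent-irrefl u (≡ᵇ⇒≡ (common u u) 1 adj) }))) ⟩
    𝟙 (α u v) * 𝟙 (A u xor A v)                ≡⟨ *-comm (𝟙 (α u v)) _ ⟩
    𝟙 (A u xor A v) * 𝟙 (α u v)                ≡⟨ 𝟙-xor (A u) (A v) (α u v) ⟨
    𝟙 (A u ∧ (not (A v) ∧ α u v)) + 𝟙 (A v ∧ (not (A u) ∧ α u v)) ∎

edgesBetween-comm : ∀ n A B → edgesBetween n A B ≡ edgesBetween n B A
edgesBetween-comm n A B = trans (∑-comm V V _)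
  (∑-congᴬ (all-vertices n) (λ v∈V → ∑-congᴬ (all-vertices n) (λ u∈V → swap v∈V u∈V)))
  where
  V = vertices n
  swap : ∀ {v u} → IsVertex n v → IsVertex n u →
    𝟙 (A u ∧ (B v ∧ does (adjacent? u v))) ≡ 𝟙 (B v ∧ (A u ∧ does (adjacent? v u)))
  swap {v} {u} v∈V u∈V = cong 𝟙 (begin
    A u ∧ (B v ∧ does (adjacent? u v))   ≡⟨ ∧-assoc (A u) (B v) _ ⟨
    (A u ∧ B v) ∧ does (adjacent? u v)   ≡⟨ cong₂ _∧_ (∧-comm (A u) (B v)) (adjacent-sym u∈V v∈V) ⟩
    (B v ∧ A u) ∧ does (adjacent? v u)   ≡⟨ ∧-assoc (B v) (A u) _ ⟩
    B v ∧ (A u ∧ does (adjacent? v u))   ∎)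
    where open ≡-Reasoning

edgesBetween≡∑degreeInto : ∀ n A B → edgesBetween n A B ≡ ∑[ u ∈ vertices n ] (𝟙 (A u) * degreeInto n B u)
edgesBetween≡∑degreeInto n A B = ∑-cong V (λ u →
  trans (∑-cong V (λ v → 𝟙-∧ (A u) (B v ∧ does (adjacent? u v)))) (∑-*ˡ V (𝟙 (A u)) _))
  where V = vertices n

edgesBetween-｛｝ˡ : ∀ {n w} B → IsVertex n w → edgesBetween n ｛ w ｝ B ≡ degreeInto n B w
edgesBetween-｛｝ˡ {n} {w} B w∈V = trans (edgesBetween≡∑degreeInto n ｛ w ｝ B) (∑-vertices-δ (degreeInto n B) w∈V)

edgesBetween-≥ : ∀ n A B k → (∀ {u} → IsVertex n u → T (A u) → k ≤ degreeInto n B u) →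
  k * card n A ≤ edgesBetween n A B
edgesBetween-≥ n A B k k≤deg = begin
  k * card n A                            ≡⟨ cong (k *_) (card≡∑ n A) ⟩
  k * ∑[ u ∈ V ] 𝟙 (A u)                  ≡⟨ ∑-*ˡ V k _ ⟨
  ∑[ u ∈ V ] (k * 𝟙 (A u))                ≤⟨ ∑-monoᴬ-≤ (all-vertices n) (λ u∈V → 𝟙-scale-≤ k _ (k≤deg u∈V)) ⟩
  ∑[ u ∈ V ] (𝟙 (A u) * degreeInto n B u) ≡⟨ edgesBetween≡∑degreeInto n A B ⟨
  edgesBetween n A B                      ∎
  where
  open ≤-Reasoning
  V = vertices n

edgesBetween-∪ : ∀ n A E → Disjoint A E →
  edgesBetween n (A ∪ E) (∁ (A ∪ E)) + edgesBetween n A E ≡ edgesBetween n A (∁ A) + edgesBetween n E (∁ (A ∪ E))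
edgesBetween-∪ n A E disj = begin
  edgesBetween n (A ∪ E) (∁ (A ∪ E)) + edgesBetween n A E
    ≡⟨ ∑∑-distrib-+ V V _ _ ⟨
  ∑[ u ∈ V ] ∑[ v ∈ V ] (𝟙 ((A u ∨ E u) ∧ (not (A v ∨ E v) ∧ α u v)) + 𝟙 (A u ∧ (E v ∧ α u v)))
    ≡⟨ ∑-cong V (λ u → ∑-cong V (λ v → 𝟙-insert (α u v) (disj u) (disj v))) ⟩
  ∑[ u ∈ V ] ∑[ v ∈ V ] (𝟙 (A u ∧ (not (A v) ∧ α u v)) + 𝟙 (E u ∧ (not (A v ∨ E v) ∧ α u v)))
    ≡⟨ ∑∑-distrib-+ V V _ _ ⟩
  edgesBetween n A (∁ A) + edgesBetween n E (∁ (A ∪ E)) ∎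
  where
  open ≡-Reasoning
  V = vertices n
  α : Vertex → Vertex → Bool
  α u v = does (adjacent? u v)

card-∪ : ∀ n A E → Disjoint A E → card n (A ∪ E) ≡ card n A + card n E
card-∪ n A E disj = begin
  card n (A ∪ E)                            ≡⟨ card≡∑ n (A ∪ E) ⟩
  ∑[ u ∈ V ] 𝟙 (A u ∨ E u)                  ≡⟨ ∑-cong V (λ u → 𝟙-∨ (disj u)) ⟩
  ∑[ u ∈ V ] (𝟙 (A u) + 𝟙 (E u))            ≡⟨ ∑-distrib-+ V _ _ ⟩
  ∑[ u ∈ V ] 𝟙 (A u) + ∑[ u ∈ V ] 𝟙 (E u)   ≡⟨ cong₂ _+_ (card≡∑ n A) (card≡∑ n E) ⟨
  card n A + card n E                       ∎
  where
  open ≡-Reasoning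
  V = vertices n

card-｛｝ : ∀ {n w} → IsVertex n w → card n ｛ w ｝ ≡ 1
card-｛｝ {n} {w} w∈V = begin
  card n ｛ w ｝                      ≡⟨ card≡∑ n ｛ w ｝ ⟩
  ∑[ v ∈ vertices n ] 𝟙 (｛ w ｝ v)     ≡⟨ ∑-cong (vertices n) (λ v → sym (*-identityʳ (𝟙 (｛ w ｝ v)))) ⟩
  ∑[ v ∈ vertices n ] (𝟙 (｛ w ｝ v) * 1) ≡⟨ ∑-vertices-δ (λ _ → 1) w∈V ⟩
  1                                  ∎
  where open ≡-Reasoning

boundary-insert : ∀ {n} A {w} → IsVertex n w → ¬ T (A w) →
  boundary n (A ∪ ｛ w ｝) + degreeInto n A w ≡ boundary n A + degreeInto n (∁ (A ∪ ｛ w ｝)) w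
boundary-insert {n} A {w} w∈V w∉A = begin
  boundary n (A ∪ ｛ w ｝) + degreeInto n A w
    ≡⟨ cong₂ _+_ (boundary≡edgesBetween n (A ∪ ｛ w ｝)) (trans (sym (edgesBetween-｛｝ˡ A w∈V)) (edgesBetween-comm n ｛ w ｝ A)) ⟩
  edgesBetween n (A ∪ ｛ w ｝) (∁ (A ∪ ｛ w ｝)) + edgesBetween n A ｛ w ｝
    ≡⟨ edgesBetween-∪ n A ｛ w ｝ (Disjoint-｛｝ {A} w∉A) ⟩
  edgesBetween n A (∁ A) + edgesBetween n ｛ w ｝ (∁ (A ∪ ｛ w ｝))
    ≡⟨ cong₂ _+_ (sym (boundary≡edgesBetween n A)) (edgesBetween-｛｝ˡ (∁ (A ∪ ｛ w ｝)) w∈V) ⟩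
  boundary n A + degreeInto n (∁ (A ∪ ｛ w ｝)) w ∎
  where open ≡-Reasoning

ratio-step : ∀ {d d′ k s} → d′ ≤ d + k → k * s ≤ d → d′ * s ≤ d * (s + 1)
ratio-step {d} {d′} {k} {s} d′≤d+k ks≤d = begin
  d′ * s          ≤⟨ *-monoˡ-≤ s d′≤d+k ⟩
  (d + k) * s     ≡⟨ *-distribʳ-+ s d k ⟩
  d * s + k * s   ≤⟨ +-monoʳ-≤ (d * s) ks≤d ⟩
  d * s + d       ≡⟨ cong (d * s +_) (*-identityʳ d) ⟨
  d * s + d * 1   ≡⟨ *-distribˡ-+ d s 1 ⟨
  d * (s + 1)     ∎
  where open ≤-Reasoning

-- The row of v is written i = suc p, so that i ∸ 1 in setS reduces to p and w = (p , j′).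
module Configuration (n p j j′ : ℕ) where

  i : ℕ
  i = suc p

  S : VSet
  S = setS n i j j′

  w : Vertex
  w = p , j′

  -- does (∈S? u) and does (∈S′? u) reduce to S u and (S ∪ ｛ w ｝) u.
  InS : Vertex → Set
  InS (a , b) = (a ≡ p × j′ < b × b ≤ n) ⊎ (1 ≤ a × a < b × b ≤ n × i ≤ a × j ≤ b)

  ∈S? : ∀ u → Dec (InS u)
  ∈S? (a , b) = ((a ≟ p) ×-dec (j′ <? b) ×-dec (b ≤? n))
         ⊎-dec ((1 ≤? a) ×-dec (a <? b) ×-dec (b ≤? n) ×-dec (i ≤? a) ×-dec (j ≤? b))

  InS′ : Vertex → Set
  InS′ (a , b) = InS (a , b) ⊎ (a ≡ p × b ≡ j′)

  ∈S′? : ∀ u → Dec (InS′ u)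
  ∈S′? (a , b) = ∈S? (a , b) ⊎-dec ((a ≟ p) ×-dec (b ≟ j′))

  row-of-S : ∀ {a b} → InS (a , b) → p ≤ a
  row-of-S (inj₁ (refl , _))          = ≤-refl
  row-of-S (inj₂ (_ , _ , _ , i≤a , _)) = <⇒≤ i≤a

  w∉S : ¬ InS w
  w∉S (inj₁ (_ , j′<j′ , _))         = <-irrefl refl j′<j′
  w∉S (inj₂ (_ , _ , _ , i≤p , _))   = <-irrefl refl i≤p

  w∈V : 1 ≤ p → i < j → j ≤ j′ → j′ ≤ n → IsVertex n w
  w∈V 1≤p i<j j≤j′ j′≤n = 1≤p , <-≤-trans (<-trans (n<1+n p) i<j) j≤j′ , j′≤n

  S′-shape : ∀ {a b} → InS′ (a , b) → (a ≡ p × j′ ≤ b) ⊎ (i ≤ a × j ≤ b)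
  S′-shape (inj₁ (inj₁ (a≡p , j′<b , _)))         = inj₁ (a≡p , <⇒≤ j′<b)
  S′-shape (inj₁ (inj₂ (_ , _ , _ , i≤a , j≤b)))  = inj₂ (i≤a , j≤b)
  S′-shape (inj₂ (a≡p , refl))                    = inj₁ (a≡p , ≤-refl)

  row-p-tail∈S′ : ∀ {d} → j′ ≤ d → d ≤ n → InS′ (p , d)
  row-p-tail∈S′ j′≤d d≤n with m≤n⇒m<n∨m≡n j′≤d
  ... | inj₁ j′<d = inj₁ (inj₁ (refl , j′<d , d≤n))
  ... | inj₂ refl = inj₂ (refl , refl)

  S′-down-closed : j ≤ j′ → ∀ {a b c d} → IsVertex n (c , d) → InS′ (a , b) → a ≤ c → b ≤ d → InS′ (c , d)
  S′-down-closed j≤j′ x∈V@(1≤c , c<d , d≤n) u∈S′ a≤c b≤d with S′-shape u∈S′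
  ... | inj₂ (i≤a , j≤b) = inj₁ (inj₂ (1≤c , c<d , d≤n , ≤-trans i≤a a≤c , ≤-trans j≤b b≤d))
  ... | inj₁ (refl , j′≤b) with m≤n⇒m<n∨m≡n a≤c
  ...   | inj₁ p<c  = inj₁ (inj₂ (1≤c , c<d , d≤n , p<c , ≤-trans j≤j′ (≤-trans j′≤b b≤d)))
  ...   | inj₂ refl = row-p-tail∈S′ (≤-trans j′≤b b≤d) d≤n

  stable : j ≤ j′ → Stable n (S ∪ ｛ w ｝)
  stable j≤j′ u x _ x∈V u∈S′ (a≤c , b≤d) = Equivalence.to T-≡ (does-complete (∈S′? x)
    (S′-down-closed j≤j′ x∈V (does-sound (∈S′? u) (Equivalence.from T-≡ u∈S′)) a≤c b≤d))

  above? : ∀ c → Dec (1 ≤ c × c < p)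
  above? c = (1 ≤? c) ×-dec (c <? p)

  between? : ∀ d → Dec (i ≤ d × d < j′)
  between? d = (i ≤? d) ×-dec (d <? j′)

  aboveIn? : ∀ e c d → Dec (d ≡ e × 1 ≤ c × c < p)
  aboveIn? e c d = (d ≟ e) ×-dec above? c

  U : List ℕ
  U = upTo (suc n)

  ∑grid : (ℕ → ℕ → ℕ) → ℕ
  ∑grid f = ∑[ c ∈ U ] ∑[ d ∈ U ] f c d

  -- This is i − 2, but only its occurrence in both degree bounds matters.
  rowsAbove : ℕ
  rowsAbove = ∑[ c ∈ U ] 𝟙 (does (above? c))

  betweenCount : ℕ
  betweenCount = ∑[ d ∈ U ] 𝟙 (does (between? d))

  outside-neighbour : ∀ {a b c d} → IsVertex n (a , b) → p ≤ a →
    (d ≡ a × 1 ≤ c × c < p) ⊎ (d ≡ b × 1 ≤ c × c < p) →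
    IsVertex n (c , d) × ¬ InS (c , d) × Adjacent (a , b) (c , d)
  outside-neighbour {a} {b} {c} (_ , a<b , b≤n) p≤a (inj₁ (refl , 1≤c , c<p)) =
    (1≤c , c<a , <⇒≤ (<-≤-trans a<b b≤n)) , (λ x∈S → <⇒≱ c<p (row-of-S x∈S)) ,
    shares-first⇒adjacent {a} {b} {c , a} (dec-true (∈pair? a (c , a)) (inj₂ refl))
                          (dec-false (∈pair? b (c , a)) [ >⇒≢ (<-trans c<a a<b) , >⇒≢ a<b ])
    where c<a = <-≤-trans c<p p≤a
  outside-neighbour {a} {b} {c} (_ , a<b , b≤n) p≤a (inj₂ (refl , 1≤c , c<p)) =
    (1≤c , <-trans c<a a<b , b≤n) , (λ x∈S → <⇒≱ c<p (row-of-S x∈S)) ,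
    shares-second⇒adjacent {a} {b} {c , b} (dec-false (∈pair? a (c , b)) [ >⇒≢ c<a , <⇒≢ a<b ])
                           (dec-true (∈pair? b (c , b)) (inj₂ refl))
    where c<a = <-≤-trans c<p p≤a

  degree-outside-S-≥ : ∀ {u} → IsVertex n u → T (S u) → rowsAbove + rowsAbove ≤ degreeInto n (∁ S) u
  degree-outside-S-≥ {a , b} u∈V@(_ , a<b , b≤n) u∈S = begin
    rowsAbove + rowsAbove
      ≡⟨ cong₂ _+_ (∑∑-column (suc n) above (<-trans a<b (s≤s b≤n))) (∑∑-column (suc n) above (s≤s b≤n)) ⟨
    ∑grid (λ c d → 𝟙 (does (aboveIn? a c d))) + ∑grid (λ c d → 𝟙 (does (aboveIn? b c d)))
      ≡⟨ ∑∑-distrib-+ U U (λ c d → 𝟙 (does (aboveIn? a c d))) (λ c d → 𝟙 (does (aboveIn? b c d))) ⟨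
    ∑grid (λ c d → 𝟙 (does (aboveIn? a c d)) + 𝟙 (does (aboveIn? b c d)))
      ≤⟨ ∑-mono-≤ U (λ c → ∑-mono-≤ U (λ d →
           𝟙-+-≤ (aboveIn? a c d) (aboveIn? b c d) (outsideS? c d)
             (λ { (refl , _) (d≡b , _) → <⇒≢ a<b d≡b })
             (outside-neighbour u∈V (row-of-S (does-sound (∈S? (a , b)) u∈S))))) ⟩
    ∑grid (λ c d → 𝟙 (does (outsideS? c d)))
      ≡⟨ degreeInto-grid n (∁ S) (a , b) ⟨
    degreeInto n (∁ S) (a , b) ∎
    where
    open ≤-Reasoning
    above : ℕ → Bool
    above c = does (above? c)
    outsideS? : ∀ c d → Dec (IsVertex n (c , d) × ¬ InS (c , d) × Adjacent (a , b) (c , d))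
    outsideS? c d = isVertex? n (c , d) ×-dec ¬? (∈S? (c , d)) ×-dec adjacent? (a , b) (c , d)

  outside-neighbour-of-w : i < j → j ≤ j′ → ∀ {c d} → IsVertex n (c , d) × ¬ InS′ (c , d) × Adjacent w (c , d) →
    (d ≡ p × 1 ≤ c × c < p) ⊎ (d ≡ j′ × 1 ≤ c × c < p) ⊎ (c ≡ p × i ≤ d × d < j′)
  outside-neighbour-of-w i<j j≤j′ {c} {d} ((1≤c , c<d , d≤n) , x∉S′ , adj) with adjacent⇒shares {p} {j′} {c , d} adj
  ... | inj₁ (inj₁ refl) with <-cmp d j′
  ...   | tri< d<j′ _ _ = inj₂ (inj₂ (refl , c<d , d<j′))
  ...   | tri≈ _ refl _ = ⊥-elim (x∉S′ (inj₂ (refl , refl)))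
  ...   | tri> _ _ j′<d = ⊥-elim (x∉S′ (inj₁ (inj₁ (refl , j′<d , d≤n))))
  outside-neighbour-of-w i<j j≤j′ ((1≤c , c<d , _) , _ , _) | inj₁ (inj₂ refl) = inj₁ (refl , 1≤c , c<d)
  outside-neighbour-of-w i<j j≤j′ ((1≤c , c<d , d≤n) , x∉S′ , _) | inj₂ (inj₁ refl) =
    ⊥-elim (x∉S′ (inj₁ (inj₂ (1≤c , c<d , d≤n , <⇒≤ (<-≤-trans i<j j≤j′) , ≤-trans j≤j′ (<⇒≤ c<d)))))
  outside-neighbour-of-w i<j j≤j′ {c} ((1≤c , c<d , d≤n) , x∉S′ , _) | inj₂ (inj₂ refl) with <-cmp c p
  ... | tri< c<p _ _ = inj₂ (inj₁ (refl , 1≤c , c<p))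
  ... | tri≈ _ refl _ = ⊥-elim (x∉S′ (inj₂ (refl , refl)))
  ... | tri> _ _ p<c = ⊥-elim (x∉S′ (inj₁ (inj₂ (1≤c , c<d , d≤n , p<c , j≤j′))))

  inside-neighbour-of-w : j ≤ j′ → j′ ≤ n → ∀ {c d} → d ≡ j′ × i ≤ c × c < j′ →
    IsVertex n (c , d) × InS (c , d) × Adjacent w (c , d)
  inside-neighbour-of-w j≤j′ j′≤n {c} (refl , i≤c , c<j′) =
    (1≤c , c<j′ , j′≤n) , inj₂ (1≤c , c<j′ , j′≤n , i≤c , j≤j′) ,
    shares-second⇒adjacent {p} {j′} {c , j′} (dec-false (∈pair? p (c , j′)) [ <⇒≢ i≤c , <⇒≢ (<-trans i≤c c<j′) ])
                                          (dec-true (∈pair? j′ (c , j′)) (inj₂ refl))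
    where 1≤c = ≤-trans (s≤s z≤n) i≤c

  degree-outside-S′-≤ : i < j → j ≤ j′ → j′ ≤ n →
    degreeInto n (∁ (S ∪ ｛ w ｝)) w ≤ rowsAbove + rowsAbove + betweenCount
  degree-outside-S′-≤ i<j j≤j′ j′≤n = begin
    degreeInto n (∁ (S ∪ ｛ w ｝)) w
      ≡⟨ degreeInto-grid n (∁ (S ∪ ｛ w ｝)) w ⟩
    ∑grid (λ c d → 𝟙 (does (outsideS′? c d)))
      ≤⟨ ∑-mono-≤ U (λ c → ∑-mono-≤ U (λ d → three-families c d)) ⟩
    ∑grid (λ c d → X c d + (Y c d + Z c d))
      ≡⟨ ∑∑-distrib-+ U U X _ ⟩
    ∑grid X + ∑grid (λ c d → Y c d + Z c d)
      ≡⟨ cong (∑grid X +_) (∑∑-distrib-+ U U Y Z) ⟩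
    ∑grid X + (∑grid Y + ∑grid Z)
      ≡⟨ cong₂ _+_ (∑∑-column (suc n) above p<N) (cong₂ _+_ (∑∑-column (suc n) above j′<N) (∑∑-row (suc n) between p<N)) ⟩
    rowsAbove + (rowsAbove + betweenCount)
      ≡⟨ +-assoc rowsAbove rowsAbove betweenCount ⟨
    rowsAbove + rowsAbove + betweenCount ∎
    where
    open ≤-Reasoning
    above between : ℕ → Bool
    above c = does (above? c)
    between d = does (between? d)
    rowW? : ∀ c d → Dec (c ≡ p × i ≤ d × d < j′)
    rowW? c d = (c ≟ p) ×-dec between? d
    X Y Z : ℕ → ℕ → ℕ
    X c d = 𝟙 (does (aboveIn? p c d))
    Y c d = 𝟙 (does (aboveIn? j′ c d))
    Z c d = 𝟙 (does (rowW? c d))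
    outsideS′? : ∀ c d → Dec (IsVertex n (c , d) × ¬ InS′ (c , d) × Adjacent w (c , d))
    outsideS′? c d = isVertex? n (c , d) ×-dec ¬? (∈S′? (c , d)) ×-dec adjacent? w (c , d)
    j′<N : j′ < suc n
    j′<N = s≤s j′≤n
    p<N : p < suc n
    p<N = <-trans (<-≤-trans (<-trans (n<1+n p) i<j) j≤j′) j′<N
    three-families : ∀ c d → 𝟙 (does (outsideS′? c d)) ≤ X c d + (Y c d + Z c d)
    three-families c d = ≤-trans
      (𝟙-≤-+ (aboveIn? p c d) (aboveIn? j′ c d ⊎-dec rowW? c d) (outsideS′? c d) (outside-neighbour-of-w i<j j≤j′))
      (+-monoʳ-≤ (X c d) (𝟙-∨-≤ (does (aboveIn? j′ c d)) (does (rowW? c d))))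

  degree-inside-S-≥ : j ≤ j′ → j′ ≤ n → betweenCount ≤ degreeInto n S w
  degree-inside-S-≥ j≤j′ j′≤n = begin
    betweenCount
      ≡⟨ ∑∑-column (suc n) (λ c → does (between? c)) (s≤s j′≤n) ⟨
    ∑grid (λ c d → 𝟙 (does ((d ≟ j′) ×-dec between? c)))
      ≤⟨ ∑-mono-≤ U (λ c → ∑-mono-≤ U (λ d →
           𝟙-mono-does ((d ≟ j′) ×-dec between? c) (insideS? c d) (inside-neighbour-of-w j≤j′ j′≤n))) ⟩
    ∑grid (λ c d → 𝟙 (does (insideS? c d)))
      ≡⟨ degreeInto-grid n S w ⟨
    degreeInto n S w ∎
    where
    open ≤-Reasoning
    insideS? : ∀ c d → Dec (IsVertex n (c , d) × InS (c , d) × Adjacent w (c , d))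
    insideS? c d = isVertex? n (c , d) ×-dec ∈S? (c , d) ×-dec adjacent? w (c , d)

  boundary-growth : 1 ≤ p → i < j → j ≤ j′ → j′ ≤ n →
    boundary n (S ∪ ｛ w ｝) ≤ boundary n S + (rowsAbove + rowsAbove)
  boundary-growth 1≤p i<j j≤j′ j′≤n = +-cancelʳ-≤ (degreeInto n S w) _ _ (begin
    boundary n (S ∪ ｛ w ｝) + degreeInto n S w
      ≡⟨ boundary-insert S (w∈V 1≤p i<j j≤j′ j′≤n) (w∉S ∘ does-sound (∈S? w)) ⟩
    boundary n S + degreeInto n (∁ (S ∪ ｛ w ｝)) w
      ≤⟨ +-monoʳ-≤ (boundary n S) (degree-outside-S′-≤ i<j j≤j′ j′≤n) ⟩
    boundary n S + (rowsAbove + rowsAbove + betweenCount)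
      ≤⟨ +-monoʳ-≤ (boundary n S) (+-monoʳ-≤ (rowsAbove + rowsAbove) (degree-inside-S-≥ j≤j′ j′≤n)) ⟩
    boundary n S + (rowsAbove + rowsAbove + degreeInto n S w)
      ≡⟨ +-assoc (boundary n S) (rowsAbove + rowsAbove) _ ⟨
    boundary n S + (rowsAbove + rowsAbove) + degreeInto n S w ∎)
    where open ≤-Reasoning

  boundary-spread : (rowsAbove + rowsAbove) * card n S ≤ boundary n S
  boundary-spread = subst ((rowsAbove + rowsAbove) * card n S ≤_) (sym (boundary≡edgesBetween n S))
    (edgesBetween-≥ n S (∁ S) (rowsAbove + rowsAbove) degree-outside-S-≥)

  card-S′ : IsVertex n w → card n (S ∪ ｛ w ｝) ≡ card n S + 1
  card-S′ w∈V = trans (card-∪ n S ｛ w ｝ (Disjoint-｛｝ {S} (w∉S ∘ does-sound (∈S? w))))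
    (cong (card n S +_) (card-｛｝ w∈V))

-- The hypotheses 1 ≤ n and j ≤ n follow from the others.
lemma2 : (n i j j' : ℕ) → 1 ≤ n → 2 ≤ i → i < j → j ≤ n → j ≤ j' → j' ≤ n →
    Stable n (setS' n i j j')
    × (boundary n (setS' n i j j') * card n (setS n i j j')
        ≤ boundary n (setS n i j j') * card n (setS' n i j j'))
lemma2 n (suc p) j j′ _ (s≤s 1≤p) i<j _ j≤j′ j′≤n =
  stable j≤j′ ,
  subst (λ s′ → boundary n (S ∪ ｛ w ｝) * card n S ≤ boundary n S * s′)
    (sym (card-S′ (w∈V 1≤p i<j j≤j′ j′≤n)))
    (ratio-step (boundary-growth 1≤p i<j j≤j′ j′≤n) boundary-spread)
  where open Configuration n p j j′
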